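{- Let $T$ be an $N\times N$ tridiagonal matrix, let $p$ be a polynomial of degree $d$, and let $v$ be the $N\times 1$ column vector with a $1$ in its last entry and $0$ elsewhere. Then the $(i,j)$ entries (indices $0,\dots,N-1$) of $p(T)$ and $p(T+vv^\top)$ agree whenever $i+j\le 2(N-1)-d$. -}

module Defs where

open import Level using (Level)
open import Data.Nat using (ℕ; zero; suc; _∸_; _<_)
open import Data.Nat.Properties using (_≟_)
open import Data.Fin using (Fin; toℕ)
import Data.Fin as Fin
open import Data.Sum using (_⊎_)
open import Relation.Nullary using (yes; no; ¬_)
open import Algebra.Bundles using (CommutativeRing)

module MatrixDefs {c ℓ : Level} (R : CommutativeRing c ℓ) where
  open CommutativeRing R

  Matrix : ℕ → Set c
  Matrix N = Fin N → Fin N → Carrier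

  ∑ : ∀ {n} → (Fin n → Carrier) → Carrier
  ∑ {zero}  f = 0#
  ∑ {suc n} f = f Fin.zero + ∑ (λ k → f (Fin.suc k))

  _⊕_ : ∀ {N} → Matrix N → Matrix N → Matrix N
  (A ⊕ B) i j = A i j + B i j

  _⊗_ : ∀ {N} → Matrix N → Matrix N → Matrix N
  (A ⊗ B) i j = ∑ (λ k → A i k * B k j)

  _·ₘ_ : ∀ {N} → Carrier → Matrix N → Matrix N
  (a ·ₘ A) i j = a * A i j

  zeroM : ∀ {N} → Matrix N
  zeroM i j = 0#

  identity : ∀ {N} → Matrix N
  identity i j with toℕ i ≟ toℕ j
  ... | yes _ = 1#
  ... | no  _ = 0#

  _^ₘ_ : ∀ {N} → Matrix N → ℕ → Matrix N
  A ^ₘ zero  = identity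
  A ^ₘ suc k = A ⊗ (A ^ₘ k)

  Tridiagonal : ∀ {N} → Matrix N → Set ℓ
  Tridiagonal {N} T = ∀ (i j : Fin N) →
    (suc (toℕ i) < toℕ j ⊎ suc (toℕ j) < toℕ i) → T i j ≈ 0#

  Poly : ℕ → Set c
  Poly d = Fin (suc d) → Carrier

  HasDegree : ∀ {d} → Poly d → Set ℓ
  HasDegree {d} p = ¬ (p (Fin.fromℕ d) ≈ 0#)

  evalPoly : ∀ {d N} → Poly d → Matrix N → Matrix N
  evalPoly {d} p A i j = ∑ (λ (k : Fin (suc d)) → p k * (A ^ₘ toℕ k) i j)

  lastVec : ∀ {N} → Fin N → Carrier
  lastVec {N} i with toℕ i ≟ N ∸ 1
  ... | yes _ = 1#
  ... | no  _ = 0#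

  outer : ∀ {N} → (Fin N → Carrier) → Matrix N
  outer v i j = v i * v j

module Submission where

-- Write S = T + v vᵀ, where v = e_{N-1}, so S differs from T only in the
-- corner entry (N-1, N-1).  The proof rests on two facts.
--
--   * Bandwidth.  Call a matrix k-banded if its (i,j) entry vanishes when
--     |i - j| > k.  A product of an r-banded and an s-banded matrix is
--     (r+s)-banded, so the k-th power of a tridiagonal matrix is k-banded.
--     S is tridiagonal as well, since v vᵀ is diagonal.
--
--   * Powers agree.  (T^k)_{ij} = (S^k)_{ij} whenever i + j + k ≤ 2(N-1),
--     by induction on k, expanding (T^{k+1})_{ij} = Σ_m T_{im} (T^k)_{mj}.
--     Only the terms with |i - m| ≤ 1 survive; for them m + j + k still fits
--     the budget, so the induction hypothesis applies, and the extra term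
--     v_i v_m (S^k)_{mj} can only be nonzero for i = m = N-1, where the budget
--     forces j + k < m, so (S^k)_{mj} = 0 by bandwidth.
--
-- Since p(A)_{ij} = Σ_{k ≤ d} a_k (A^k)_{ij}, the theorem follows termwise.

open import Defs
open import Level using (Level)
open import Data.Nat using (ℕ; zero; suc; _∸_; _≤_; _<_; _<?_; z≤n)
import Data.Nat as Nat
open import Data.Nat.Properties using (_≟_; ≮⇒≥)
import Data.Nat.Properties as NatP
open import Data.Fin using (Fin; toℕ)
open import Data.Fin.Properties using (toℕ≤pred[n])
open import Data.Product using (_×_; _,_)
open import Data.Sum using (_⊎_; inj₁; inj₂)
open import Data.Empty using (⊥-elim)
open import Function using (_∘_)
open import Relation.Nullary using (¬_; Dec; yes; no)
open import Relation.Nullary.Decidable using (_⊎-dec_)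
open import Relation.Binary.PropositionalEquality as ≡ using (_≡_; _≢_; cong; subst)
open import Algebra.Bundles using (CommutativeRing)
import Relation.Binary.Reasoning.Setoid as SetoidReasoning

module Distance where
  open Nat using (_+_; _*_)
  open NatP using (<⇒≢; ≤-<-trans; m≤n+m; +-suc; +-comm; +-assoc; +-identityʳ;
                   +-monoˡ-≤; +-monoʳ-≤; +-cancelˡ-≤; +-cancelˡ-<)

  -- `Apart k a b` says |a - b| > k.  With k written on the left, `Apart 1`
  -- is literally the side condition in the definition of `Tridiagonal`.
  Apart : ℕ → ℕ → ℕ → Set
  Apart k a b = k + a < b ⊎ k + b < a

  apart? : ∀ k a b → Dec (Apart k a b)
  apart? k a b = (k + a <? b) ⊎-dec (k + b <? a)

  apart⇒≢ : ∀ {k a b} → Apart k a b → a ≢ b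
  apart⇒≢ {k} {a} (inj₁ k+a<b) = <⇒≢ (≤-<-trans (m≤n+m a k) k+a<b)
  apart⇒≢ {k} {a} {b} (inj₂ k+b<a) = <⇒≢ (≤-<-trans (m≤n+m b k) k+b<a) ∘ ≡.sym

  apart-weaken : ∀ {r s a b} → r ≤ s → Apart s a b → Apart r a b
  apart-weaken {a = a} r≤s (inj₁ lt) = inj₁ (≤-<-trans (+-monoˡ-≤ a r≤s) lt)
  apart-weaken {b = b} r≤s (inj₂ lt) = inj₂ (≤-<-trans (+-monoˡ-≤ b r≤s) lt)

  apart-transfer : ∀ r s {a b m} → Apart (r + s) a b → ¬ Apart r a m → Apart s m b
  apart-transfer r s {a} {b} {m} (inj₁ far) near = inj₁ (begin-strict
      s + m        ≤⟨ +-monoʳ-≤ s (≮⇒≥ (near ∘ inj₁)) ⟩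
      s + (r + a)  ≡⟨ ≡.sym (+-assoc s r a) ⟩
      s + r + a    ≡⟨ cong (_+ a) (+-comm s r) ⟩
      r + s + a    <⟨ far ⟩
      b            ∎)
    where open NatP.≤-Reasoning
  apart-transfer r s {a} {b} {m} (inj₂ far) near = inj₂ (+-cancelˡ-< r (s + b) m (begin-strict
      r + (s + b)  ≡⟨ ≡.sym (+-assoc r s b) ⟩
      r + s + b    <⟨ far ⟩
      a            ≤⟨ ≮⇒≥ (near ∘ inj₂) ⟩
      r + m        ∎))
    where open NatP.≤-Reasoning

  budget-step : ∀ {a b k m B} → a + b + suc k ≤ B → m ≤ suc a → m + b + k ≤ B
  budget-step {a} {b} {k} {m} {B} budget m≤1+a = begin
    m + b + k        ≤⟨ +-monoˡ-≤ k (+-monoˡ-≤ b m≤1+a) ⟩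
    suc (a + b + k)  ≡⟨ ≡.sym (+-suc (a + b) k) ⟩
    a + b + suc k    ≤⟨ budget ⟩
    B                ∎
    where open NatP.≤-Reasoning

  corner-gap : ∀ {n b k} → n + b + suc k ≤ 2 * n → k + b < n
  corner-gap {n} {b} {k} budget = +-cancelˡ-≤ n (suc (k + b)) n (begin
    n + suc (k + b)  ≡⟨ cong (λ x → n + suc x) (+-comm k b) ⟩
    n + suc (b + k)  ≡⟨ cong (n +_) (≡.sym (+-suc b k)) ⟩
    n + (b + suc k)  ≡⟨ ≡.sym (+-assoc n b (suc k)) ⟩
    n + b + suc k    ≤⟨ budget ⟩
    2 * n            ≡⟨ cong (n +_) (+-identityʳ n) ⟩
    n + n            ∎)
    where open NatP.≤-Reasoning

open Distance

module BandedMatrices {c ℓ : Level} (R : CommutativeRing c ℓ) where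
  open CommutativeRing R
  open MatrixDefs R
  open SetoidReasoning setoid

  ∑-cong : ∀ {n} {f g : Fin n → Carrier} → (∀ k → f k ≈ g k) → ∑ f ≈ ∑ g
  ∑-cong {zero}  f≈g = refl
  ∑-cong {suc n} f≈g = +-cong (f≈g Fin.zero) (∑-cong (f≈g ∘ Fin.suc))

  ∑-zero : ∀ {n} {f : Fin n → Carrier} → (∀ k → f k ≈ 0#) → ∑ f ≈ 0#
  ∑-zero {zero}  f≈0 = refl
  ∑-zero {suc n} f≈0 = trans (+-cong (f≈0 Fin.zero) (∑-zero (f≈0 ∘ Fin.suc))) (+-identityʳ 0#)

  zero-*ˡ : ∀ {a x} → a ≈ 0# → a * x ≈ 0#
  zero-*ˡ {x = x} a≈0 = trans (*-cong a≈0 refl) (zeroˡ x)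

  zero-*ʳ : ∀ {a x} → x ≈ 0# → a * x ≈ 0#
  zero-*ʳ {a} x≈0 = trans (*-cong refl x≈0) (zeroʳ a)

  -- A matrix is k-banded if its entries vanish at distance > k from the
  -- diagonal; `Tridiagonal` is by definition `Banded 1`.
  Banded : ∀ {N} → ℕ → Matrix N → Set ℓ
  Banded k A = ∀ i j → Apart k (toℕ i) (toℕ j) → A i j ≈ 0#

  banded-weaken : ∀ {N r s} {A : Matrix N} → r ≤ s → Banded r A → Banded s A
  banded-weaken r≤s bandA i j = bandA i j ∘ apart-weaken r≤s

  ⊕-banded : ∀ {N k} {A B : Matrix N} → Banded k A → Banded k B → Banded k (A ⊕ B)
  ⊕-banded bandA bandB i j apart =
    trans (+-cong (bandA i j apart) (bandB i j apart)) (+-identityʳ 0#)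

  -- Bandwidths add under multiplication: in Σ_m A_{im} B_{mj}, either
  -- |i - m| > r or, by the triangle inequality, |m - j| > s.
  ⊗-banded : ∀ {N r s} {A B : Matrix N} → Banded r A → Banded s B → Banded (r Nat.+ s) (A ⊗ B)
  ⊗-banded {r = r} {s} {A} {B} bandA bandB i j apart = ∑-zero term
    where
    term : ∀ m → A i m * B m j ≈ 0#
    term m with apart? r (toℕ i) (toℕ m)
    ... | yes far  = zero-*ˡ (bandA i m far)
    ... | no  near = zero-*ʳ (bandB m j (apart-transfer r s apart near))

  identity-diagonal : ∀ {N} → Banded 0 (identity {N})
  identity-diagonal i j apart with toℕ i ≟ toℕ j
  ... | yes i≡j = ⊥-elim (apart⇒≢ apart i≡j)
  ... | no  _   = refl

  power-banded : ∀ {N} {A : Matrix N} → Tridiagonal A → ∀ k → Banded k (A ^ₘ k)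
  power-banded tri zero    = identity-diagonal
  power-banded tri (suc k) = ⊗-banded tri (power-banded tri k)

  lastVec-off : ∀ {N} (i : Fin N) → toℕ i ≢ N ∸ 1 → lastVec i ≈ 0#
  lastVec-off {N} i i≢last with toℕ i ≟ N ∸ 1
  ... | yes i≡last = ⊥-elim (i≢last i≡last)
  ... | no  _      = refl

  lastVec-product : ∀ {N} (i m : Fin N) →
    lastVec i * lastVec m ≈ 0# ⊎ (toℕ i ≡ N ∸ 1 × toℕ m ≡ N ∸ 1)
  lastVec-product {N} i m = by-cases (toℕ i ≟ N ∸ 1) (toℕ m ≟ N ∸ 1)
    where
    by-cases : Dec (toℕ i ≡ N ∸ 1) → Dec (toℕ m ≡ N ∸ 1) →
      lastVec i * lastVec m ≈ 0# ⊎ (toℕ i ≡ N ∸ 1 × toℕ m ≡ N ∸ 1)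
    by-cases (no  i≢last) _              = inj₁ (zero-*ˡ (lastVec-off i i≢last))
    by-cases (yes _)      (no  m≢last)   = inj₁ (zero-*ʳ (lastVec-off m m≢last))
    by-cases (yes i≡last) (yes m≡last)   = inj₂ (i≡last , m≡last)

  outer-lastVec-diagonal : ∀ {N} → Banded 0 (outer (lastVec {N}))
  outer-lastVec-diagonal i j apart with lastVec-product i j
  ... | inj₁ vv≈0              = vv≈0
  ... | inj₂ (i≡last , j≡last) = ⊥-elim (apart⇒≢ apart (≡.trans i≡last (≡.sym j≡last)))

  perturb : ∀ {N} → Matrix N → Matrix N
  perturb T = T ⊕ outer lastVec

  perturb-tridiagonal : ∀ {N} {T : Matrix N} → Tridiagonal T → Tridiagonal (perturb T)
  perturb-tridiagonal tri = ⊕-banded tri (banded-weaken z≤n outer-lastVec-diagonal)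

  powers-agree : ∀ {N} {T : Matrix N} → Tridiagonal T → ∀ k (i j : Fin N) →
    toℕ i Nat.+ toℕ j Nat.+ k ≤ 2 Nat.* (N ∸ 1) → (T ^ₘ k) i j ≈ (perturb T ^ₘ k) i j
  powers-agree tri zero i j _ = refl
  powers-agree {N} {T} tri (suc k) i j budget = ∑-cong term
    where
    S : Matrix N
    S = perturb T

    term : ∀ m → T i m * (T ^ₘ k) m j ≈ S i m * (S ^ₘ k) m j
    term m with apart? 1 (toℕ i) (toℕ m)
    ... | yes far = trans (zero-*ˡ (tri i m far)) (sym (zero-*ˡ (perturb-tridiagonal tri i m far)))
    ... | no near = begin
      T i m * (T ^ₘ k) m j                    ≈⟨ *-cong refl induction ⟩
      T i m * X                               ≈⟨ sym (+-identityʳ _) ⟩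
      T i m * X + 0#                          ≈⟨ +-cong refl (sym corner-term) ⟩
      T i m * X + lastVec i * lastVec m * X   ≈⟨ sym (distribʳ X _ _) ⟩
      S i m * X                               ∎
      where
      X : Carrier
      X = (S ^ₘ k) m j

      induction : (T ^ₘ k) m j ≈ X
      induction = powers-agree tri k m j (budget-step budget (≮⇒≥ (near ∘ inj₁)))

      -- The rank-one term only touches the corner, where (S^k)_{mj} = 0.
      corner-term : lastVec i * lastVec m * X ≈ 0#
      corner-term with lastVec-product i m
      ... | inj₁ vv≈0              = zero-*ˡ vv≈0
      ... | inj₂ (i≡last , m≡last) =
        zero-*ʳ (power-banded (perturb-tridiagonal tri) k m j (inj₂ gap))
        where
        gap : k Nat.+ toℕ j < toℕ m
        gap = subst (k Nat.+ toℕ j <_) (≡.sym m≡last)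
                (corner-gap (subst (λ a → a Nat.+ toℕ j Nat.+ suc k ≤ 2 Nat.* (N ∸ 1)) i≡last budget))

open BandedMatrices using (∑-cong; powers-agree)
open Nat using (_+_; _*_)
open NatP using (≤-trans; +-monoʳ-≤)

-- p(A)_{ij} = Σ_{k ≤ d} a_k (A^k)_{ij}, and each power agrees since k ≤ d.
-- The leading coefficient plays no role: the bound holds for deg p ≤ d.
proposition7p2 : ∀ {c ℓ : Level} (R : CommutativeRing c ℓ) (N d : ℕ)
    (T : MatrixDefs.Matrix R N) → MatrixDefs.Tridiagonal R T →
    (p : MatrixDefs.Poly R d) → MatrixDefs.HasDegree R p →
    (i j : Fin N) → toℕ i + toℕ j + d ≤ 2 * (N ∸ 1) →
    CommutativeRing._≈_ R (MatrixDefs.evalPoly R p T i j)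
      (MatrixDefs.evalPoly R p (MatrixDefs._⊕_ R T (MatrixDefs.outer R (MatrixDefs.lastVec R))) i j)
proposition7p2 R N d T tri p _ i j budget =
  ∑-cong R (λ k → *-cong (refl {p k}) (powers-agree R tri (toℕ k) i j (degree-budget k)))
  where
  open CommutativeRing R using (*-cong; refl)

  degree-budget : (k : Fin (suc d)) → toℕ i + toℕ j + toℕ k ≤ 2 * (N ∸ 1)
  degree-budget k = ≤-trans (+-monoʳ-≤ (toℕ i + toℕ j) (toℕ≤pred[n] k)) budget
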